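{- For every integer $m\geq 3$, $\lambda_1^1(P_2 \times C_m)=2$ if $m\equiv 0 \pmod 3$, and $\lambda_1^1(P_2\times C_m)=3$ otherwise.
   Context: For a graph $G$, an $L(1,1)$-labeling with labels in $\{0,1,\dots,p\}$ is a function $l:V(G)\to\{0,1,\dots,p\}$ such that $l(u)\neq l(v)$ whenever the distance $d(u,v)$ is $1$ or $2$. $\lambda_1^1(G)$ denotes the least $p$ for which $G$ admits such a labeling. $P_m$ denotes the path with $m$ vertices and $C_m$ the cycle with $m$ vertices. The direct product $G\times H$ has vertex set $V(G)\times V(H)$, with $(x_1,x_2)$ adjacent to $(y_1,y_2)$ iff $x_1y_1\in E(G)$ and $x_2y_2\in E(H)$. -}

module Defs where

open import Data.Nat using (ℕ; suc; _≤_; _%_; _+_)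
open import Data.Fin using (Fin; toℕ)
open import Data.Product using (_×_; ∃; Σ)
open import Data.Sum using (_⊎_)
open import Relation.Nullary using (¬_)
open import Relation.Binary.PropositionalEquality using (_≡_)
open import Level using (0ℓ)

record Graph : Set₁ where
  field
    V   : Set
    Adj : V → V → Set
open Graph public

Dist12 : (G : Graph) → V G → V G → Set
Dist12 G u v = ¬ (u ≡ v) × (Adj G u v ⊎ ∃ λ w → Adj G u w × Adj G w v)

IsL11Labeling : (G : Graph) (p : ℕ) → (V G → Fin (suc p)) → Set
IsL11Labeling G p l = ∀ u v → Dist12 G u v → ¬ (l u ≡ l v)

HasL11Labeling : Graph → ℕ → Set
HasL11Labeling G p = Σ (V G → Fin (suc p)) (IsL11Labeling G p)

λ11≡ : Graph → ℕ → Set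
λ11≡ G p = HasL11Labeling G p × (∀ q → HasL11Labeling G q → p ≤ q)

Path : ℕ → Graph
Path m = record
  { V = Fin m
  ; Adj = λ i j → (toℕ j ≡ suc (toℕ i)) ⊎ (toℕ i ≡ suc (toℕ j)) }

-- Cycle C_m (used for m ≥ 3) on vertices 0,…,m-1, i ~ i+1 (mod m)
CycAdj : (m : ℕ) → Fin m → Fin m → Set
CycAdj m i j = (toℕ j ≡ suc (toℕ i)) ⊎ ((suc (toℕ i) ≡ m) × (toℕ j ≡ 0))

Cycle : (m : ℕ) → Graph
Cycle m = record
  { V = Fin m
  ; Adj = λ i j → CycAdj m i j ⊎ CycAdj m j i }

_×ᵍ_ : Graph → Graph → Graph
G ×ᵍ H = record
  { V = V G × V H
  ; Adj = λ x y → Adj G (Data.Product.proj₁ x) (Data.Product.proj₁ y)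
                × Adj H (Data.Product.proj₂ x) (Data.Product.proj₂ y) }

-- Upper bounds: label P₂ × C_m by a labeling of C_m at distance ≤ 2, the same on both rows:
-- 0 1 2 repeated when 3 ∣ m, and (0 1 2)ᵃ (0 1 2 3)ᵇ⁺¹ when m = 3a + 4(b + 1), which covers
-- every m ≥ 3 with 3 ∤ m except m = 5; P₂ × C₅ is a 10-cycle and is labelled directly.
-- Lower bounds: along the closed walk t ↦ (t mod 2 , t mod m) of length 2m any three
-- consecutive vertices are pairwise at distance ≤ 2. Hence three labels are needed, and
-- with exactly three labels the labels along the walk are 3-periodic, forcing 3 ∣ 2m.
module Submission where

open import Defs
open import Data.Nat using (ℕ; zero; suc; _+_; _*_; _≤_; _<_; _%_; _/_; s≤s; z≤n; NonZero)
open import Data.Nat.Properties using (+-comm; *-comm; suc-injective; 1+n≢n; m≢1+n+m; <-irrefl; m≤n⇒m<n∨m≡n)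
open import Data.Nat.DivMod using (_mod_; m%n<n; m≡m%n+[m/n]*n; [m+kn]%n≡m%n; m<n⇒m%n≡m; n%n≡0)
open import Data.Nat.Divisibility using (_∤_; _∣?_; m%n≡0⇒n∣m; n∣m⇒m%n≡0)
open import Data.Nat.Primality using (euclidsLemma; prime?)
open import Data.Fin using (Fin; zero; suc; toℕ; #_; punchOut)
open import Data.Fin.Properties using (toℕ-injective; toℕ<n; toℕ-fromℕ<; fromℕ<-cong; punchOut-injective)
open import Data.Product using (_×_; _,_; proj₁; proj₂)
open import Data.Sum using (_⊎_; inj₁; inj₂; swap; [_,_])
open import Function using (_∘_)
open import Relation.Nullary using (¬_; contradiction)
open import Relation.Nullary.Decidable using (from-yes; from-no)
open import Relation.Binary.PropositionalEquality
  using (_≡_; _≢_; refl; sym; trans; cong; cong₂; subst; subst₂; ≢-sym; module ≡-Reasoning)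

fin2-unique-other : (x y z : Fin 2) → x ≢ z → y ≢ z → x ≡ y
fin2-unique-other zero       zero       _          _   _   = refl
fin2-unique-other (suc zero) (suc zero) _          _   _   = refl
fin2-unique-other zero       (suc zero) zero       x≢z _   = contradiction refl x≢z
fin2-unique-other zero       (suc zero) (suc zero) _   y≢z = contradiction refl y≢z
fin2-unique-other (suc zero) zero       zero       _   y≢z = contradiction refl y≢z
fin2-unique-other (suc zero) zero       (suc zero) x≢z _   = contradiction refl x≢z

fin3-unique-other : ∀ {b c : Fin 3} → b ≢ c → (x y : Fin 3) →
                    x ≢ b → x ≢ c → y ≢ b → y ≢ c → x ≡ y
fin3-unique-other b≢c x y x≢b x≢c y≢b y≢c =
  punchOut-injective b≢x b≢y
    (fin2-unique-other _ _ (punchOut b≢c)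
      (x≢c ∘ punchOut-injective b≢x b≢c) (y≢c ∘ punchOut-injective b≢y b≢c))
  where
  b≢x : _ ≢ x
  b≢x = ≢-sym x≢b
  b≢y : _ ≢ y
  b≢y = ≢-sym y≢b

distinct₃⇒2≤ : ∀ {q} {x y z : Fin (suc q)} → x ≢ y → x ≢ z → y ≢ z → 2 ≤ q
distinct₃⇒2≤ {zero}        {zero} {zero}   x≢y _   _   = contradiction refl x≢y
distinct₃⇒2≤ {suc zero}    {x}    {y} {z}  x≢y x≢z y≢z = contradiction (fin2-unique-other x y z x≢z y≢z) x≢y
distinct₃⇒2≤ {suc (suc q)} _ _ _ = s≤s (s≤s z≤n)

fin3-periodic : (f : ℕ → Fin 3) → (∀ t → f t ≢ f (suc t)) → (∀ t → f t ≢ f (suc (suc t))) →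
                ∀ k t → f (k * 3 + t) ≡ f t
fin3-periodic f step skip zero    t = refl
fin3-periodic f step skip (suc k) t = trans period (fin3-periodic f step skip k t)
  where
  s : ℕ
  s = k * 3 + t
  period : f (3 + s) ≡ f s
  period = fin3-unique-other (step (1 + s)) (f (3 + s)) (f s)
             (≢-sym (skip (1 + s))) (≢-sym (step (2 + s))) (step s) (skip s)

record Dist12Walk (G : Graph) (N : ℕ) : Set where
  field
    vertex : ℕ → V G
    step   : ∀ t → Dist12 G (vertex t) (vertex (suc t))
    skip   : ∀ t → Dist12 G (vertex t) (vertex (suc (suc t)))
    closed : vertex N ≡ vertex 0

module _ {G : Graph} {N : ℕ} (W : Dist12Walk G N) where
  open Dist12Walk W

  walk⇒2≤ : ∀ {q} → HasL11Labeling G q → 2 ≤ q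
  walk⇒2≤ (_ , valid) = distinct₃⇒2≤ (valid _ _ (step 0)) (valid _ _ (skip 0)) (valid _ _ (step 1))

  walk⇒no-3-labeling : 3 ∤ N → ¬ HasL11Labeling G 2
  walk⇒no-3-labeling 3∤N (l , valid) = noReturn (N % 3) (m%n<n N 3) (3∤N ∘ m%n≡0⇒n∣m N 3) returns
    where
    open ≡-Reasoning
    f : ℕ → Fin 3
    f t = l (vertex t)
    returns : f (N % 3) ≡ f 0
    returns = begin
      f (N % 3)             ≡⟨ fin3-periodic f (λ t → valid _ _ (step t)) (λ t → valid _ _ (skip t)) (N / 3) (N % 3) ⟨
      f (N / 3 * 3 + N % 3) ≡⟨ cong f (+-comm (N / 3 * 3) (N % 3)) ⟩
      f (N % 3 + N / 3 * 3) ≡⟨ cong f (m≡m%n+[m/n]*n N 3) ⟨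
      f N                   ≡⟨ cong l closed ⟩
      f 0                   ∎
    noReturn : ∀ r → r < 3 → r ≢ 0 → f r ≢ f 0
    noReturn 0 _ r≢0 = contradiction refl r≢0
    noReturn 1 _ _   = ≢-sym (valid _ _ (step 0))
    noReturn 2 _ _   = ≢-sym (valid _ _ (skip 0))
    noReturn (suc (suc (suc _))) (s≤s (s≤s (s≤s ()))) _

  walk⇒3≤ : 3 ∤ N → ∀ {q} → HasL11Labeling G q → 3 ≤ q
  walk⇒3≤ 3∤N lab with m≤n⇒m<n∨m≡n (walk⇒2≤ lab)
  ... | inj₁ 2<q  = 2<q
  ... | inj₂ refl = contradiction lab (walk⇒no-3-labeling 3∤N)

-- CycAdj m i j unfolds to CycSucc m (toℕ i) (toℕ j).
CycSucc : ℕ → ℕ → ℕ → Set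
CycSucc m x y = (y ≡ suc x) ⊎ ((suc x ≡ m) × (y ≡ 0))

cycSucc-injective : ∀ {m x y k} → CycSucc m x k → CycSucc m y k → x ≡ y
cycSucc-injective (inj₁ refl)         (inj₁ k≡1+y)        = suc-injective k≡1+y
cycSucc-injective (inj₁ refl)         (inj₂ (_ , ()))
cycSucc-injective (inj₂ (_ , refl))   (inj₁ ())
cycSucc-injective (inj₂ (1+x≡m , _))  (inj₂ (1+y≡m , _))  = suc-injective (trans 1+x≡m (sym 1+y≡m))

cycSucc-functional : ∀ {m k x y} → x < m → y < m → CycSucc m k x → CycSucc m k y → x ≡ y
cycSucc-functional _   _   (inj₁ refl)         (inj₁ refl)         = refl
cycSucc-functional x<m _   (inj₁ refl)         (inj₂ (1+k≡m , _))  = contradiction x<m (<-irrefl 1+k≡m)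
cycSucc-functional _   y<m (inj₂ (1+k≡m , _))  (inj₁ refl)         = contradiction y<m (<-irrefl 1+k≡m)
cycSucc-functional _   _   (inj₂ (_ , refl))   (inj₂ (_ , refl))   = refl

cycSucc-irrefl : ∀ {m x} → 2 ≤ m → ¬ CycSucc m x x
cycSucc-irrefl _ (inj₁ x≡1+x) = 1+n≢n (sym x≡1+x)
cycSucc-irrefl (s≤s ()) (inj₂ (refl , refl))

cycSucc-no-2-cycle : ∀ {m x k} → 3 ≤ m → CycSucc m x k → ¬ CycSucc m k x
cycSucc-no-2-cycle _                (inj₁ refl)         (inj₁ x≡2+x)       = m≢1+n+m _ x≡2+x
cycSucc-no-2-cycle (s≤s (s≤s ()))   (inj₁ refl)         (inj₂ (refl , refl))
cycSucc-no-2-cycle (s≤s (s≤s ()))   (inj₂ (refl , refl)) (inj₁ refl)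

suc-% : ∀ m .{{_ : NonZero m}} t → suc t % m ≡ suc (t % m) % m
suc-% m t = begin
  suc t % m                   ≡⟨ cong (λ x → suc x % m) (m≡m%n+[m/n]*n t m) ⟩
  suc (t % m + t / m * m) % m ≡⟨ [m+kn]%n≡m%n (suc (t % m)) (t / m) m ⟩
  suc (t % m) % m             ∎
  where open ≡-Reasoning

%-cycSucc : ∀ m .{{_ : NonZero m}} t → CycSucc m (t % m) (suc t % m)
%-cycSucc m t with m≤n⇒m<n∨m≡n (m%n<n t m)
... | inj₁ 1+r<m = inj₁ (trans (suc-% m t) (m<n⇒m%n≡m 1+r<m))
... | inj₂ 1+r≡m = inj₂ (1+r≡m , trans (suc-% m t) (trans (cong (_% m) 1+r≡m) (n%n≡0 m)))

module _ {m : ℕ} .{{_ : NonZero m}} where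

  mod-cycSucc : ∀ t → CycSucc m (toℕ (t mod m)) (toℕ (suc t mod m))
  mod-cycSucc t = subst₂ (CycSucc m) (sym (toℕ-fromℕ< _)) (sym (toℕ-fromℕ< _)) (%-cycSucc m t)

  mod-step : 2 ≤ m → ∀ t → t mod m ≢ suc t mod m
  mod-step 2≤m t e = cycSucc-irrefl 2≤m (subst (CycSucc m _) (cong toℕ (sym e)) (mod-cycSucc t))

  mod-skip : 3 ≤ m → ∀ t → t mod m ≢ suc (suc t) mod m
  mod-skip 3≤m t e =
    cycSucc-no-2-cycle 3≤m (mod-cycSucc t) (subst (CycSucc m _) (cong toℕ (sym e)) (mod-cycSucc (suc t)))

  mod-periodic : ∀ i k → (i + k * m) mod m ≡ i mod m
  mod-periodic i k = fromℕ<-cong _ _ ([m+kn]%n≡m%n i k m) _ _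

path-adj⇒≢ : ∀ {m} {i j : Fin m} → Adj (Path m) i j → i ≢ j
path-adj⇒≢ (inj₁ j≡1+i) refl = 1+n≢n (sym j≡1+i)
path-adj⇒≢ (inj₂ i≡1+j) refl = 1+n≢n (sym i≡1+j)

path2-two-step : ∀ {a c b : Fin 2} → Adj (Path 2) a c → Adj (Path 2) c b → a ≡ b
path2-two-step a~c c~b = fin2-unique-other _ _ _ (path-adj⇒≢ a~c) (≢-sym (path-adj⇒≢ c~b))

alternate : ℕ → Fin 2
alternate zero          = zero
alternate (suc zero)    = suc zero
alternate (suc (suc t)) = alternate t

alternate-adj : ∀ t → Adj (Path 2) (alternate t) (alternate (suc t))
alternate-adj zero          = inj₁ refl
alternate-adj (suc zero)    = inj₂ refl
alternate-adj (suc (suc t)) = alternate-adj t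

alternate-even : ∀ k → alternate (k * 2) ≡ zero
alternate-even zero    = refl
alternate-even (suc k) = alternate-even k

zigzag : ∀ {m} → 3 ≤ m → Dist12Walk (Path 2 ×ᵍ Cycle m) (m * 2)
zigzag {m@(suc _)} 3≤m = record
  { vertex = vertex
  ; step   = λ t → path-adj⇒≢ (alternate-adj t) ∘ cong proj₁ , inj₁ (adj t)
  ; skip   = λ t → mod-skip 3≤m t ∘ cong proj₂ , inj₂ (vertex (suc t) , adj t , adj (suc t))
  ; closed = cong₂ _,_ (alternate-even m) (trans (cong (_mod m) (*-comm m 2)) (mod-periodic 0 2))
  }
  where
  vertex : ℕ → Fin 2 × Fin m
  vertex t = alternate t , t mod m
  adj : ∀ t → Adj (Path 2 ×ᵍ Cycle m) (vertex t) (vertex (suc t))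
  adj t = alternate-adj t , inj₁ (mod-cycSucc t)

-- g a i is the label of the vertex (a , i) of P₂ × C_{n+2}.
record CyclicRows (n p : ℕ) (g : Fin 2 → ℕ → Fin (suc p)) : Set where
  field
    step      : ∀ a b → Adj (Path 2) a b → ∀ x → suc x < suc (suc n) → g a x ≢ g b (suc x)
    stepWrap  : ∀ a b → Adj (Path 2) a b → g a (suc n) ≢ g b 0
    skip      : ∀ a x → suc (suc x) < suc (suc n) → g a x ≢ g a (suc (suc x))
    skipWrap₀ : ∀ a → g a n ≢ g a 0
    skipWrap₁ : ∀ a → g a (suc n) ≢ g a 1

rows⇒labeling : ∀ {n p g} → CyclicRows n p g → HasL11Labeling (Path 2 ×ᵍ Cycle (suc (suc n))) p
rows⇒labeling {n} {p} {g} rows = label , valid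
  where
  open CyclicRows rows
  m : ℕ
  m = suc (suc n)

  label : Fin 2 × Fin m → Fin (suc p)
  label (a , i) = g a (toℕ i)

  step-ok : ∀ {a b x y} → Adj (Path 2) a b → y < m → CycSucc m x y → g a x ≢ g b y
  step-ok a~b y<m (inj₁ refl)          = step _ _ a~b _ y<m
  step-ok a~b _   (inj₂ (refl , refl)) = stepWrap _ _ a~b

  skip-ok : ∀ a {x k y} → y < m → CycSucc m x k → CycSucc m k y → g a x ≢ g a y
  skip-ok a y<m (inj₁ refl)          (inj₁ refl)          = skip a _ y<m
  skip-ok a _   (inj₁ refl)          (inj₂ (refl , refl)) = skipWrap₀ a
  skip-ok a _   (inj₂ (refl , refl)) (inj₁ refl)          = skipWrap₁ a
  skip-ok a _   (inj₂ (refl , refl)) (inj₂ (() , _))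

  same-row : ∀ a {i k j : Fin m} → Adj (Cycle m) i k → Adj (Cycle m) k j → i ≢ j → label (a , i) ≢ label (a , j)
  same-row a {i} {k} {j} (inj₁ i→k) (inj₁ k→j) _ = skip-ok a (toℕ<n j) i→k k→j
  same-row a {i} {k} {j} (inj₂ k→i) (inj₂ j→k) _ = ≢-sym (skip-ok a (toℕ<n i) j→k k→i)
  same-row a (inj₁ i→k) (inj₂ j→k) i≢j = contradiction (toℕ-injective (cycSucc-injective i→k j→k)) i≢j
  same-row a {i} {k} {j} (inj₂ k→i) (inj₁ k→j) i≢j =
    contradiction (toℕ-injective (cycSucc-functional (toℕ<n i) (toℕ<n j) k→i k→j)) i≢j

  valid : IsL11Labeling (Path 2 ×ᵍ Cycle m) p label
  valid (a , i) (b , j) (_ , inj₁ (a~b , inj₁ i→j)) = step-ok a~b (toℕ<n j) i→j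
  valid (a , i) (b , j) (_ , inj₁ (a~b , inj₂ j→i)) = ≢-sym (step-ok (swap a~b) (toℕ<n i) j→i)
  valid (a , i) (b , j) (u≢v , inj₂ (_ , (a~c , i~k) , (c~b , k~j))) with path2-two-step a~c c~b
  ... | refl = same-row a i~k k~j (u≢v ∘ cong (a ,_))

-- The wrap-around constraints become ordinary step/skip constraints of s at positions n, n + 1.
constantRows : ∀ {n p} {s : ℕ → Fin (suc p)} →
               (∀ x → s x ≢ s (suc x)) → (∀ x → s x ≢ s (suc (suc x))) →
               s (2 + n) ≡ s 0 → s (3 + n) ≡ s 1 → CyclicRows n p (λ _ → s)
constantRows {n} {s = s} step skip s[m]≡s[0] s[m+1]≡s[1] = record
  { step      = λ _ _ _ x _ → step x
  ; stepWrap  = λ _ _ _ → subst (s (suc n) ≢_) s[m]≡s[0] (step (suc n))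
  ; skip      = λ _ x _ → skip x
  ; skipWrap₀ = λ _ → subst (s n ≢_) s[m]≡s[0] (skip n)
  ; skipWrap₁ = λ _ → subst (s (suc n) ≢_) s[m+1]≡s[1] (skip (suc n))
  }

labeling-3k : ∀ k → HasL11Labeling (Path 2 ×ᵍ Cycle (3 + k * 3)) 2
labeling-3k k = rows⇒labeling (constantRows (mod-step 2≤3) (mod-skip 3≤3)
                                 (mod-periodic 0 (suc k)) (mod-periodic 1 (suc k)))
  where
  2≤3 : 2 ≤ 3
  2≤3 = s≤s (s≤s z≤n)
  3≤3 : 3 ≤ 3
  3≤3 = s≤s (s≤s (s≤s z≤n))

blocks : ℕ → ℕ → Fin 4
blocks zero    t                   = t mod 4
blocks (suc a) 0                   = # 0
blocks (suc a) 1                   = # 1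
blocks (suc a) 2                   = # 2
blocks (suc a) (suc (suc (suc t))) = blocks a t

blocks-0 : ∀ a → blocks a 0 ≡ # 0
blocks-0 zero    = refl
blocks-0 (suc a) = refl

blocks-1 : ∀ a → blocks a 1 ≡ # 1
blocks-1 zero    = refl
blocks-1 (suc a) = refl

blocks-tail : ∀ a t → blocks a (t + a * 3) ≡ t mod 4
blocks-tail a t = trans (cong (blocks a) (+-comm t (a * 3))) (go a)
  where
  go : ∀ a → blocks a (a * 3 + t) ≡ t mod 4
  go zero    = refl
  go (suc a) = go a

blocks-step : ∀ a t → blocks a t ≢ blocks a (suc t)
blocks-step zero    t                   = mod-step (s≤s (s≤s z≤n)) t
blocks-step (suc a) 0                   = λ ()
blocks-step (suc a) 1                   = λ ()
blocks-step (suc a) 2                   = λ e → contradiction (trans e (blocks-0 a)) λ ()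
blocks-step (suc a) (suc (suc (suc t))) = blocks-step a t

blocks-skip : ∀ a t → blocks a t ≢ blocks a (suc (suc t))
blocks-skip zero    t                   = mod-skip (s≤s (s≤s (s≤s z≤n))) t
blocks-skip (suc a) 0                   = λ ()
blocks-skip (suc a) 1                   = λ e → contradiction (trans e (blocks-0 a)) λ ()
blocks-skip (suc a) 2                   = λ e → contradiction (trans e (blocks-1 a)) λ ()
blocks-skip (suc a) (suc (suc (suc t))) = blocks-skip a t

labeling-4b+3a : ∀ a b → HasL11Labeling (Path 2 ×ᵍ Cycle (suc b * 4 + a * 3)) 3
labeling-4b+3a a b = rows⇒labeling (constantRows (blocks-step a) (blocks-skip a)
  (trans (blocks-tail a (suc b * 4)) (trans (mod-periodic 0 (suc b)) (sym (blocks-0 a))))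
  (trans (blocks-tail a (suc (suc b * 4))) (trans (mod-periodic 1 (suc b)) (sym (blocks-1 a)))))

-- P₂ × C₅ is the 10-cycle (0,0) (1,1) (0,2) (1,3) (0,4) (1,0) (0,1) (1,2) (0,3) (1,4);
-- the rows are read off its labeling 0 1 2 0 1 2 0 1 2 3.
pentagonRows : Fin 2 → ℕ → Fin 4
pentagonRows zero 0 = # 0
pentagonRows zero 1 = # 0
pentagonRows zero 2 = # 2
pentagonRows zero 3 = # 2
pentagonRows zero 4 = # 1
pentagonRows (suc zero) 0 = # 2
pentagonRows (suc zero) 1 = # 1
pentagonRows (suc zero) 2 = # 1
pentagonRows (suc zero) 3 = # 0
pentagonRows (suc zero) 4 = # 3
pentagonRows _ _ = # 0

pentagon : CyclicRows 3 3 pentagonRows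
pentagon = record
  { step      = step
  ; stepWrap  = λ { zero (suc zero) _ () ; (suc zero) zero _ ()
                  ; zero zero (inj₁ ()) ; zero zero (inj₂ ())
                  ; (suc zero) (suc zero) (inj₁ ()) ; (suc zero) (suc zero) (inj₂ ()) }
  ; skip      = skip
  ; skipWrap₀ = λ { zero () ; (suc zero) () }
  ; skipWrap₁ = λ { zero () ; (suc zero) () }
  }
  where
  step : ∀ a b → Adj (Path 2) a b → ∀ x → suc x < 5 → pentagonRows a x ≢ pentagonRows b (suc x)
  step zero       zero       (inj₁ ())
  step zero       zero       (inj₂ ())
  step (suc zero) (suc zero) (inj₁ ())
  step (suc zero) (suc zero) (inj₂ ())
  step zero       (suc zero) _ 0 _ ()
  step zero       (suc zero) _ 1 _ ()
  step zero       (suc zero) _ 2 _ ()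
  step zero       (suc zero) _ 3 _ ()
  step (suc zero) zero       _ 0 _ ()
  step (suc zero) zero       _ 1 _ ()
  step (suc zero) zero       _ 2 _ ()
  step (suc zero) zero       _ 3 _ ()
  step _ _ _ (suc (suc (suc (suc _)))) (s≤s (s≤s (s≤s (s≤s (s≤s ())))))
  skip : ∀ a x → suc (suc x) < 5 → pentagonRows a x ≢ pentagonRows a (suc (suc x))
  skip zero       0 _ ()
  skip zero       1 _ ()
  skip zero       2 _ ()
  skip (suc zero) 0 _ ()
  skip (suc zero) 1 _ ()
  skip (suc zero) 2 _ ()
  skip _ (suc (suc (suc _))) (s≤s (s≤s (s≤s (s≤s (s≤s ())))))

data ByResidue3 : ℕ → Set where
  zero-mod3 : ∀ k → ByResidue3 (3 + k * 3)
  one-mod3  : ∀ k → ByResidue3 (4 + k * 3)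
  five      : ByResidue3 5
  two-mod3  : ∀ k → ByResidue3 (8 + k * 3)

byResidue3 : ∀ {m} → 3 ≤ m → ByResidue3 m
byResidue3 (s≤s (s≤s (s≤s {n = n} _))) = go n
  where
  go : ∀ n → ByResidue3 (3 + n)
  go 0 = zero-mod3 0
  go 1 = one-mod3 0
  go 2 = five
  go (suc (suc (suc n))) with go n
  ... | zero-mod3 k = zero-mod3 (suc k)
  ... | one-mod3 k  = one-mod3 (suc k)
  ... | five        = two-mod3 0
  ... | two-mod3 k  = two-mod3 (suc k)

%3≡0⇒labeling₂ : ∀ {m} → 3 ≤ m → m % 3 ≡ 0 → HasL11Labeling (Path 2 ×ᵍ Cycle m) 2
%3≡0⇒labeling₂ 3≤m m%3≡0 with byResidue3 3≤m
... | zero-mod3 k = labeling-3k k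
... | one-mod3 k  = contradiction (trans (sym ([m+kn]%n≡m%n 1 (suc k) 3)) m%3≡0) λ ()
... | five        = contradiction m%3≡0 λ ()
... | two-mod3 k  = contradiction (trans (sym ([m+kn]%n≡m%n 2 (2 + k) 3)) m%3≡0) λ ()

%3≢0⇒labeling₃ : ∀ {m} → 3 ≤ m → m % 3 ≢ 0 → HasL11Labeling (Path 2 ×ᵍ Cycle m) 3
%3≢0⇒labeling₃ 3≤m m%3≢0 with byResidue3 3≤m
... | zero-mod3 k = contradiction ([m+kn]%n≡m%n 0 (suc k) 3) m%3≢0
... | one-mod3 k  = labeling-4b+3a k 0
... | five        = rows⇒labeling pentagon
... | two-mod3 k  = labeling-4b+3a k 1

3∤m⇒3∤m*2 : ∀ {m} → 3 ∤ m → 3 ∤ m * 2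
3∤m⇒3∤m*2 {m} 3∤m = [ 3∤m , from-no (3 ∣? 2) ] ∘ euclidsLemma m 2 (from-yes (prime? 3))

mainTheorem7 : (m : ℕ) → 3 ≤ m →
    ((m % 3 ≡ 0) → λ11≡ (Path 2 ×ᵍ Cycle m) 2)
    × (¬ (m % 3 ≡ 0) → λ11≡ (Path 2 ×ᵍ Cycle m) 3)
mainTheorem7 m 3≤m =
    (λ m%3≡0 → %3≡0⇒labeling₂ 3≤m m%3≡0 , λ _ → walk⇒2≤ (zigzag 3≤m))
  , (λ m%3≢0 → %3≢0⇒labeling₃ 3≤m m%3≢0 , λ _ → walk⇒3≤ (zigzag 3≤m) (3∤m⇒3∤m*2 (m%3≢0 ∘ n∣m⇒m%n≡0 m 3)))
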